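{- Let $n\ge3$ and $A\in\mathscr S^*_s(n)$ with parameters $c=c(A)$, $v=v(A)$, $s=s(A)$, $\bar c=c(\bar A)$, $\bar v=v(\bar A)$, $\bar s=s(\bar A)$ satisfying $c+\bar c\ge n$ and $\bar v<\min\{2\bar c-\bar s,\,n-c-1\}$. Then there exists $A_1\in\mathscr S^*(n)$ whose parameters $c_1=c(A_1)$, $v_1=v(A_1)$, $s_1=s(A_1)$, $\bar c_1=c(\bar A_1)$, $\bar v_1=v(\bar A_1)$, $\bar s_1=s(\bar A_1)$ satisfy $c_1=c$, $v_1=v$, $s_1=s$, $\bar c_1=\bar c$, $\bar v_1=\min\{2\bar c_1-\bar s_1,\,n-c_1-1\}$ and $\bar s_1\ge\bar s$. Moreover, $\phi(A)=\phi(A_1)$ and $\phi(\bar A)<\phi(\bar A_1)$.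
   Context: $\mathscr S(n)$ is the set of $n\times n$ $(0,1)$-matrices with zero diagonal. $\mathscr S^*(n)$ is the set of $A=(a_{ij})\in\mathscr S(n)$ with $a_{12}=a_{21}=1$, $a_{n-1,n}=a_{n,n-1}=0$, and such that whenever $a_{ij}=1$, also $a_{hk}=1$ for all $h\le i$, $k\le j$ with $h\neq k$. $\mathscr S^*_s(n)$ is the set of symmetric matrices in $\mathscr S^*(n)$. For $A\in\mathscr S^*(n)$ with row sums $r_1,\dots,r_n$: $c(A)=\max\{i\in[n]: r_1+\cdots+r_i>i(i-1)\}$, $v(A)=r_{c(A)+1}$, $s(A)=\sum_{i=1}^{c(A)}r_i-c(A)(c(A)-1)$, and $\phi(A)=\frac12\left(v-1+\sqrt{(2c-v-1)^2+4s}\right)$ with $c=c(A),v=v(A),s=s(A)$. For $A=(a_{ij})\in\mathscr S^*(n)$, $\bar A=(\bar a_{ij})$ is the $n\times n$ matrix with zero diagonal and $\bar a_{ij}=1-a_{n-j+1,n-i+1}$ for $i\neq j$ (the reflection of $J_n-I_n-A$ about the anti-diagonal); it again lies in $\mathscr S^*(n)$. -}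

module Defs where

open import Data.Bool using (Bool; true; false; if_then_else_; not)
open import Data.Nat as ℕ using (ℕ; zero; suc; _+_; _*_; _∸_)
open import Data.Nat.Properties using (_<?_)
open import Data.Fin as Fin using (Fin; toℕ; opposite)
open import Data.Fin.Properties using () renaming (_≟_ to _≟ᶠ_)
open import Data.Integer as ℤ using (ℤ; +_)
open import Data.Rational as ℚ using (ℚ; _/_)
open import Data.Product using (Σ; _×_; ∃)
open import Data.Sum using (_⊎_)
open import Data.Empty using (⊥)
open import Relation.Nullary using (¬_; yes; no)
open import Relation.Binary.PropositionalEquality using (_≡_; _≢_)

Mat : ℕ → Set
Mat n = Fin n → Fin n → Bool

-- 1-based access with natural-number indices; out-of-range entries are false (0).
ent : ∀ {n} → Mat n → ℕ → ℕ → Bool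
ent {n} A i j with i | j
... | zero | _ = false
... | suc _ | zero = false
... | suc i' | suc j' with i' <? n | j' <? n
...   | yes p | yes q = A (Fin.fromℕ< p) (Fin.fromℕ< q)
...   | _ | _ = false

InS : ∀ {n} → Mat n → Set
InS {n} A = ∀ (i : Fin n) → A i i ≡ false

InSStar : ∀ {n} → Mat n → Set
InSStar {n} A =
  InS A ×
  ent A 1 2 ≡ true × ent A 2 1 ≡ true ×
  ent A (n ∸ 1) n ≡ false × ent A n (n ∸ 1) ≡ false ×
  (∀ (i j h k : Fin n) → A i j ≡ true →
     toℕ h ℕ.≤ toℕ i → toℕ k ℕ.≤ toℕ j → h ≢ k → A h k ≡ true)

Symmetric : ∀ {n} → Mat n → Set
Symmetric {n} A = ∀ (i j : Fin n) → A i j ≡ A j i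

InSStarSym : ∀ {n} → Mat n → Set
InSStarSym A = InSStar A × Symmetric A

b2n : Bool → ℕ
b2n true = 1
b2n false = 0

sumTo : (ℕ → ℕ) → ℕ → ℕ
sumTo f zero = 0
sumTo f (suc m) = sumTo f m + f (suc m)

rowSum : ∀ {n} → Mat n → ℕ → ℕ
rowSum {n} A i = sumTo (λ j → b2n (ent A i j)) n

partialSum : ∀ {n} → Mat n → ℕ → ℕ
partialSum A i = sumTo (rowSum A) i

-- largest i ≤ m with i ≥ 1 and r_1+...+r_i > i(i-1); 0 if none
cSearch : ∀ {n} → Mat n → ℕ → ℕ
cSearch A zero = zero
cSearch A (suc i) with (suc i * i) <? partialSum A (suc i)
... | yes _ = suc i
... | no _ = cSearch A i

cOf : ∀ {n} → Mat n → ℕ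
cOf {n} A = cSearch A n

vOf : ∀ {n} → Mat n → ℕ
vOf A = rowSum A (suc (cOf A))

-- s(A) = r_1+...+r_c - c(c-1)   (nonnegative, indeed positive, by choice of c)
sOf : ∀ {n} → Mat n → ℕ
sOf A = partialSum A (cOf A) ∸ (cOf A * (cOf A ∸ 1))

bar : ∀ {n} → Mat n → Mat n
bar A i j with i ≟ᶠ j
... | yes _ = false
... | no _ = not (A (opposite j) (opposite i))

-- Real numbers of the form (a + √D)/2 with a ∈ ℤ, D ∈ ℕ, compared
-- through rational cuts (Dedekind style).

record Surd : Set where
  constructor surd
  field
    a : ℤ
    D : ℕ

ℤtoℚ : ℤ → ℚ
ℤtoℚ z = z / 1

sqrt<ℚ : ℕ → ℚ → Set
sqrt<ℚ D q = (ℚ.0ℚ ℚ.< q) × (ℤtoℚ (+ D) ℚ.< q ℚ.* q)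

ℚ<sqrt : ℚ → ℕ → Set
ℚ<sqrt q D = (q ℚ.< ℚ.0ℚ) ⊎ (q ℚ.* q ℚ.< ℤtoℚ (+ D))

-- (a + √D)/2 < q   iff   √D < 2q - a
_<ℚ'_ : Surd → ℚ → Set
surd a D <ℚ' q = sqrt<ℚ D ((ℤtoℚ (+ 2) ℚ.* q) ℚ.- ℤtoℚ a)

-- q < (a + √D)/2   iff   2q - a < √D
_ℚ<'_ : ℚ → Surd → Set
q ℚ<' surd a D = ℚ<sqrt ((ℤtoℚ (+ 2) ℚ.* q) ℚ.- ℤtoℚ a) D

_<ᵣ_ : Surd → Surd → Set
x <ᵣ y = ∃ λ (q : ℚ) → (x <ℚ' q) × (q ℚ<' y)

_≈ᵣ_ : Surd → Surd → Set
x ≈ᵣ y = ¬ (x <ᵣ y) × ¬ (y <ᵣ x)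

φ : ∀ {n} → Mat n → Surd
φ A = surd (+ vOf A ℤ.- + 1)
           (ℤ.∣ t ∣ * ℤ.∣ t ∣ + 4 * sOf A)
  where
    t : ℤ
    t = (+ (2 * cOf A)) ℤ.- (+ vOf A) ℤ.- (+ 1)

module Submission where

-- Put B = Ā, c̄ = c(B), m = c̄ + 1 and w = n - c - 1, and let B_K be B with the first K cells of its top
-- m rows (taken column by column) set to 1. B_K is the bar of the matrix A_K obtained from A by deleting
-- the reflected cells; A_K stays in 𝒮*(n), and for K ≤ w m the deleted cells lie below row c + 1, so c, v
-- and s do not change. From K to K + 1 both r₁ + ⋯ + r_m(B_K) and r_m(B_K) grow by at most one; they start
-- below m c̄ and w, and r_m(B_{w m}) ≥ w. At the first K where one of them reaches its bound, the rows of
-- B_K beyond m are still those of B, each at most v̄ + 1 ≤ 2 c̄ by the staircase shape, so c(B_K) = c̄ and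
-- v(B_K) = min(2 c̄ - s(B_K), w). Finally φ = c - 1 + z with z the positive root of z² + (2c - v - 1) z = s,
-- which is strictly increasing in (v, s); a rational between the two roots separates φ(Ā) from φ(Ā_K).

open import Defs
open import Data.Nat using (ℕ; _≤_; _+_; _*_)
import Data.Nat as ℕ using (_<_)

module Crossings where
  open import Data.Nat using (ℕ; zero; suc; _≤_)
  open import Data.Nat.Properties using (≤-refl; m≤n⇒m≤1+n)
  open import Data.Product using (∃; _×_; _,_)
  open import Relation.Nullary using (¬_; yes; no; contradiction)
  open import Relation.Unary using (Pred; Decidable)

  first-crossing : ∀ {ℓ} {P : Pred ℕ ℓ} → Decidable P → ¬ P 0 → ∀ {N} → P N →
                   ∃ λ k → suc k ≤ N × ¬ P k × P (suc k)
  first-crossing P? ¬P0 {zero} P0 = contradiction P0 ¬P0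
  first-crossing P? ¬P0 {suc N} P1+N with P? N
  ... | no ¬PN = N , ≤-refl , ¬PN , P1+N
  ... | yes PN with first-crossing P? ¬P0 PN
  ...   | k , 1+k≤N , ¬Pk , P1+k = k , m≤n⇒m≤1+n 1+k≤N , ¬Pk , P1+k

module FiniteSums where
  open import Data.Bool using (true; false; T)
  open import Data.Nat
  open import Data.Nat.Properties
  open import Data.Sum using (inj₁; inj₂)
  open import Relation.Nullary using (yes; no; contradiction)
  open import Relation.Binary.PropositionalEquality
  open import Algebra.Properties.CommutativeSemigroup +-commutativeSemigroup using (interchange)

  sumTo-cong : ∀ {f g} m → (∀ j → 1 ≤ j → j ≤ m → f j ≡ g j) → sumTo f m ≡ sumTo g m
  sumTo-cong zero f≡g = refl
  sumTo-cong (suc m) f≡g =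
    cong₂ _+_ (sumTo-cong m λ j 1≤j j≤m → f≡g j 1≤j (m≤n⇒m≤1+n j≤m)) (f≡g (suc m) (s≤s z≤n) ≤-refl)

  sumTo-mono-≤ : ∀ {f g} m → (∀ j → 1 ≤ j → j ≤ m → f j ≤ g j) → sumTo f m ≤ sumTo g m
  sumTo-mono-≤ zero f≤g = z≤n
  sumTo-mono-≤ (suc m) f≤g =
    +-mono-≤ (sumTo-mono-≤ m λ j 1≤j j≤m → f≤g j 1≤j (m≤n⇒m≤1+n j≤m)) (f≤g (suc m) (s≤s z≤n) ≤-refl)

  sumTo-+ : ∀ f g m → sumTo (λ j → f j + g j) m ≡ sumTo f m + sumTo g m
  sumTo-+ f g zero = refl
  sumTo-+ f g (suc m) = trans (cong (_+ (f (suc m) + g (suc m))) (sumTo-+ f g m))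
                              (interchange (sumTo f m) (sumTo g m) (f (suc m)) (g (suc m)))

  sumTo-*ˡ : ∀ k f m → sumTo (λ j → k * f j) m ≡ k * sumTo f m
  sumTo-*ˡ k f zero = sym (*-zeroʳ k)
  sumTo-*ˡ k f (suc m) = trans (cong (_+ k * f (suc m)) (sumTo-*ˡ k f m)) (sym (*-distribˡ-+ k _ _))

  sumTo-const : ∀ k m → sumTo (λ _ → k) m ≡ m * k
  sumTo-const k zero = refl
  sumTo-const k (suc m) = trans (cong (_+ k) (sumTo-const k m)) (+-comm (m * k) k)

  sumTo-≤-* : ∀ {f} b m → (∀ j → 1 ≤ j → j ≤ m → f j ≤ b) → sumTo f m ≤ m * b
  sumTo-≤-* b m f≤b = ≤-trans (sumTo-mono-≤ m f≤b) (≤-reflexive (sumTo-const b m))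

  sumTo-monoʳ-≤ : ∀ f {a b} → a ≤ b → sumTo f a ≤ sumTo f b
  sumTo-monoʳ-≤ f {b = zero} z≤n = ≤-refl
  sumTo-monoʳ-≤ f {b = suc b} a≤1+b with m≤n⇒m<n∨m≡n a≤1+b
  ... | inj₁ a<1+b = ≤-trans (sumTo-monoʳ-≤ f (s≤s⁻¹ a<1+b)) (m≤m+n _ _)
  ... | inj₂ refl = ≤-refl

  term≤sumTo : ∀ f {j m} → 1 ≤ j → j ≤ m → f j ≤ sumTo f m
  term≤sumTo f {suc j} _ j≤m = ≤-trans (m≤n+m _ (sumTo f j)) (sumTo-monoʳ-≤ f j≤m)

  ≤-sumTo : ∀ {f} w m → w ≤ m → (∀ j → 1 ≤ j → j ≤ w → 1 ≤ f j) → w ≤ sumTo f m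
  ≤-sumTo {f} w m w≤m 1≤f = begin
    w                  ≡⟨ *-identityʳ w ⟨
    w * 1              ≡⟨ sumTo-const 1 w ⟨
    sumTo (λ _ → 1) w  ≤⟨ sumTo-mono-≤ w 1≤f ⟩
    sumTo f w          ≤⟨ sumTo-monoʳ-≤ f w≤m ⟩
    sumTo f m          ∎
    where open ≤-Reasoning

  δ : ℕ → ℕ → ℕ
  δ k j = b2n (j ≡ᵇ k)

  δ-≤1 : ∀ k j → δ k j ≤ 1
  δ-≤1 k j with j ≡ᵇ k
  ... | true = ≤-refl
  ... | false = z≤n

  δ-diag : ∀ k → δ k k ≡ 1
  δ-diag zero = refl
  δ-diag (suc k) = δ-diag k

  δ-offdiag : ∀ {k j} → j ≢ k → δ k j ≡ 0
  δ-offdiag {k} {j} j≢k with j ≡ᵇ k in eq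
  ... | false = refl
  ... | true = contradiction (≡ᵇ⇒≡ j k (subst T (sym eq) _)) j≢k

  sumTo-δ-below : ∀ k m → m < k → sumTo (δ k) m ≡ 0
  sumTo-δ-below k m m<k = trans (sumTo-cong m λ j _ j≤m → δ-offdiag λ j≡k → <⇒≱ m<k (subst (_≤ m) j≡k j≤m))
                                (trans (sumTo-const 0 m) (*-zeroʳ m))

  sumTo-δ-≤1 : ∀ k m → sumTo (δ k) m ≤ 1
  sumTo-δ-≤1 k zero = z≤n
  sumTo-δ-≤1 k (suc m) with suc m ≟ k
  ... | yes refl = ≤-reflexive (cong₂ _+_ (sumTo-δ-below (suc m) m ≤-refl) (δ-diag (suc m)))
  ... | no 1+m≢k = ≤-trans (≤-reflexive (trans (cong (sumTo (δ k) m +_) (δ-offdiag 1+m≢k)) (+-identityʳ _)))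
                            (sumTo-δ-≤1 k m)

  sumTo-δ : ∀ {k} m → 1 ≤ k → k ≤ m → sumTo (δ k) m ≡ 1
  sumTo-δ {k} m 1≤k k≤m = ≤-antisym (sumTo-δ-≤1 k m)
    (≤-trans (≤-reflexive (sym (δ-diag k))) (term≤sumTo (δ k) 1≤k k≤m))

module MaximalExcess where
  open import Data.Nat
  open import Data.Nat.Properties
  open import Data.Nat.Tactic.RingSolver using (solve-∀)
  open import Data.Sum using (_⊎_; inj₁; inj₂)
  open import Relation.Nullary using (¬_; yes; no; contradiction)
  open import Relation.Binary.Definitions using (tri<; tri≈; tri>)
  open import Relation.Binary.PropositionalEquality

  Excess : ∀ {n} → Mat n → ℕ → Set
  Excess M i = i * (i ∸ 1) < partialSum M i

  next-square : ∀ {i} → 1 ≤ i → i * (i ∸ 1) + 2 * i ≡ suc i * i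
  next-square {suc j} _ = expand j
    where
    expand : ∀ j → suc j * j + 2 * suc j ≡ suc (suc j) * suc j
    expand = solve-∀

  module _ {n} (M : Mat n) where

    Excess⇒1≤ : ∀ {i} → Excess M i → 1 ≤ i
    Excess⇒1≤ {suc i} _ = s≤s z≤n

    cSearch-≤ : ∀ N → cSearch M N ≤ N
    cSearch-≤ zero = z≤n
    cSearch-≤ (suc N) with suc N * N <? partialSum M (suc N)
    ... | yes _ = ≤-refl
    ... | no _ = m≤n⇒m≤1+n (cSearch-≤ N)

    cSearch-excess : ∀ N → cSearch M N ≡ 0 ⊎ Excess M (cSearch M N)
    cSearch-excess zero = inj₁ refl
    cSearch-excess (suc N) with suc N * N <? partialSum M (suc N)
    ... | yes excess = inj₂ excess
    ... | no _ = cSearch-excess N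

    cSearch-maximal : ∀ N {i} → cSearch M N < i → i ≤ N → ¬ Excess M i
    cSearch-maximal zero c<i i≤0 = contradiction (≤-trans c<i i≤0) λ ()
    cSearch-maximal (suc N) {i} c<i i≤1+N with suc N * N <? partialSum M (suc N)
    ... | yes _ = contradiction i≤1+N (<⇒≱ c<i)
    ... | no ¬excess with m≤n⇒m<n∨m≡n i≤1+N
    ...   | inj₁ i<1+N = cSearch-maximal N c<i (s≤s⁻¹ i<1+N)
    ...   | inj₂ refl = ¬excess

    cOf-excess : 1 ≤ cOf M → Excess M (cOf M)
    cOf-excess 1≤c with cSearch-excess n
    ... | inj₁ c≡0 = contradiction (subst (1 ≤_) c≡0 1≤c) λ ()
    ... | inj₂ excess = excess

    partialSum-≤-beyond : ∀ {k} → partialSum M (suc k) ≤ suc k * k → (∀ i → suc k < i → rowSum M i ≤ 2 * k) →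
                          ∀ i → k < i → partialSum M i ≤ i * (i ∸ 1)
    partialSum-≤-beyond {k} base rows (suc i) (s≤s k≤i) with m≤n⇒m<n∨m≡n k≤i
    ... | inj₂ refl = base
    ... | inj₁ k<i = begin
      partialSum M i + rowSum M (suc i)  ≤⟨ +-mono-≤ (partialSum-≤-beyond base rows i k<i) (rows (suc i) (s≤s k<i)) ⟩
      i * (i ∸ 1) + 2 * k                ≤⟨ +-monoʳ-≤ (i * (i ∸ 1)) (*-monoʳ-≤ 2 (<⇒≤ k<i)) ⟩
      i * (i ∸ 1) + 2 * i                ≡⟨ next-square (≤-trans (s≤s z≤n) k<i) ⟩
      suc i * i                          ∎
      where open ≤-Reasoning

    cOf-unique : ∀ {c} → c ≤ n → Excess M c → (∀ i → c < i → i ≤ n → ¬ Excess M i) → cOf M ≡ c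
    cOf-unique {c} c≤n excess maximal with <-cmp (cOf M) c
    ... | tri< cOf<c _ _ = contradiction excess (cSearch-maximal n cOf<c c≤n)
    ... | tri≈ _ cOf≡c _ = cOf≡c
    ... | tri> _ _ c<cOf = contradiction (cOf-excess (≤-trans (Excess⇒1≤ excess) (<⇒≤ c<cOf)))
                                         (maximal (cOf M) c<cOf (cSearch-≤ n))

module Matrices {n : ℕ} where
  open import Data.Bool using (Bool; true; false; not)
  open import Data.Bool.Properties using (¬-not)
  open import Data.Nat
  open import Data.Nat.Properties
  open import Data.Fin using (Fin; toℕ; fromℕ<; opposite)
  open import Data.Fin.Properties using (toℕ<n; fromℕ<-toℕ; toℕ-fromℕ<; toℕ-injective; opposite-prop; opposite-involutive)
    renaming (_≟_ to _≟ᶠ_)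
  open import Data.Product using (∃; ∃₂; _×_; _,_)
  open import Data.Sum using (_⊎_; inj₁; inj₂)
  open import Relation.Nullary using (¬_; yes; no; contradiction)
  open import Relation.Binary.PropositionalEquality
  open FiniteSums
  open MaximalExcess

  ent-toℕ : ∀ (M : Mat n) x y → ent M (suc (toℕ x)) (suc (toℕ y)) ≡ M x y
  ent-toℕ M x y with toℕ x <? n | toℕ y <? n
  ... | yes p | yes q = cong₂ M (fromℕ<-toℕ x p) (fromℕ<-toℕ y q)
  ... | no ¬p | _ = contradiction (toℕ<n x) ¬p
  ... | yes _ | no ¬q = contradiction (toℕ<n y) ¬q

  ent-cases : ∀ i j → (∀ (M : Mat n) → ent M i j ≡ false)
                    ⊎ ∃₂ λ (x y : Fin n) → i ≡ suc (toℕ x) × j ≡ suc (toℕ y)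
  ent-cases zero j = inj₁ λ _ → refl
  ent-cases (suc i) zero = inj₁ λ _ → refl
  ent-cases (suc i) (suc j) with i <? n | j <? n
  ... | yes p | yes q = inj₂ (fromℕ< p , fromℕ< q , cong suc (sym (toℕ-fromℕ< p)) , cong suc (sym (toℕ-fromℕ< q)))
  ... | yes _ | no _ = inj₁ λ _ → refl
  ... | no _ | _ = inj₁ λ _ → refl

  ent-rel : (R : ℕ → ℕ → Bool → Bool → Set) → (∀ i j → R i j false false) → {M M′ : Mat n} →
            (∀ x y → R (suc (toℕ x)) (suc (toℕ y)) (M x y) (M′ x y)) →
            ∀ i j → R i j (ent M i j) (ent M′ i j)
  ent-rel R R-ff {M} {M′} R-inside i j with ent-cases i j
  ... | inj₁ outside rewrite outside M | outside M′ = R-ff i j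
  ... | inj₂ (x , y , refl , refl) rewrite ent-toℕ M x y | ent-toℕ M′ x y = R-inside x y

  ent-pred : (P : ℕ → ℕ → Bool → Set) → (∀ i j → P i j false) → {M : Mat n} →
             (∀ x y → P (suc (toℕ x)) (suc (toℕ y)) (M x y)) → ∀ i j → P i j (ent M i j)
  ent-pred P P-f {M} = ent-rel (λ i j a _ → P i j a) (λ i j → P-f i j) {M} {M}

  index-toℕ : ∀ {i} → 1 ≤ i → i ≤ n → ∃ λ (x : Fin n) → i ≡ suc (toℕ x)
  index-toℕ {suc i} _ i<n = fromℕ< i<n , cong suc (sym (toℕ-fromℕ< i<n))

  b2n-≤1 : ∀ b → b2n b ≤ 1
  b2n-≤1 true = ≤-refl
  b2n-≤1 false = z≤n

  b2n-mono : ∀ {a b} → (a ≡ true → b ≡ true) → b2n a ≤ b2n b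
  b2n-mono {false} _ = z≤n
  b2n-mono {true} a⇒b rewrite a⇒b refl = ≤-refl

  _⊆_ : Mat n → Mat n → Set
  M ⊆ M′ = ∀ x y → M x y ≡ true → M′ x y ≡ true

  ent-mono : ∀ {M M′} → M ⊆ M′ → ∀ i j → ent M i j ≡ true → ent M′ i j ≡ true
  ent-mono M⊆M′ = ent-rel (λ _ _ a b → a ≡ true → b ≡ true) (λ _ _ → λ ()) M⊆M′

  rowSum-mono : ∀ {M M′} → M ⊆ M′ → ∀ i → rowSum M i ≤ rowSum M′ i
  rowSum-mono M⊆M′ i = sumTo-mono-≤ n λ j _ _ → b2n-mono (ent-mono M⊆M′ i j)

  partialSum-mono : ∀ {M M′} → M ⊆ M′ → ∀ i → partialSum M i ≤ partialSum M′ i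
  partialSum-mono M⊆M′ i = sumTo-mono-≤ i λ k _ _ → rowSum-mono M⊆M′ k

  rowSum-cong : ∀ {M M′} i → (∀ x y → suc (toℕ x) ≡ i → M x y ≡ M′ x y) → rowSum M i ≡ rowSum M′ i
  rowSum-cong i same = sumTo-cong n λ j _ _ →
    cong b2n (ent-rel (λ i′ _ a b → i′ ≡ i → a ≡ b) (λ _ _ _ → refl) same i j refl)

  rowSum-step : ∀ {M M′} a b → (∀ x y → b2n (M′ x y) ≤ b2n (M x y) + δ a (toℕ x) * δ b (toℕ y)) →
                ∀ i → rowSum M′ i ≤ rowSum M i + δ (suc a) i
  rowSum-step {M} {M′} a b step i = begin
    rowSum M′ i                                                 ≤⟨ sumTo-mono-≤ n (λ j _ _ → pointwise j) ⟩
    sumTo (λ j → b2n (ent M i j) + δ (suc a) i * δ (suc b) j) n  ≡⟨ sumTo-+ _ _ n ⟩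
    rowSum M i + sumTo (λ j → δ (suc a) i * δ (suc b) j) n       ≡⟨ cong (rowSum M i +_) (sumTo-*ˡ (δ (suc a) i) _ n) ⟩
    rowSum M i + δ (suc a) i * sumTo (δ (suc b)) n               ≤⟨ +-monoʳ-≤ (rowSum M i) (*-monoʳ-≤ (δ (suc a) i) (sumTo-δ-≤1 (suc b) n)) ⟩
    rowSum M i + δ (suc a) i * 1                                 ≡⟨ cong (rowSum M i +_) (*-identityʳ _) ⟩
    rowSum M i + δ (suc a) i                                     ∎
    where
    open ≤-Reasoning
    pointwise : ∀ j → b2n (ent M′ i j) ≤ b2n (ent M i j) + δ (suc a) i * δ (suc b) j
    pointwise = ent-rel (λ i j m m′ → b2n m′ ≤ b2n m + δ (suc a) i * δ (suc b) j) (λ _ _ → z≤n) step i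

  rowSum-≤-pred : ∀ {M} → InS M → ∀ {i} → 1 ≤ i → i ≤ n → rowSum M i ≤ n ∸ 1
  rowSum-≤-pred {M} noLoops {i} 1≤i i≤n = m+n≤o⇒m≤o∸n (rowSum M i) (begin
    rowSum M i + 1                                ≡⟨ cong (rowSum M i +_) (sumTo-δ n 1≤i i≤n) ⟨
    rowSum M i + sumTo (δ i) n                    ≡⟨ sumTo-+ _ (δ i) n ⟨
    sumTo (λ j → b2n (ent M i j) + δ i j) n        ≤⟨ sumTo-≤-* 1 n (λ j _ _ → pointwise j) ⟩
    n * 1                                         ≡⟨ *-identityʳ n ⟩
    n                                             ∎)
    where
    open ≤-Reasoning
    inside : ∀ x y → b2n (M x y) + δ (suc (toℕ x)) (suc (toℕ y)) ≤ 1
    inside x y with x ≟ᶠ y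
    ... | yes refl rewrite noLoops x = δ-≤1 (toℕ x) (toℕ x)
    ... | no x≢y rewrite δ-offdiag {toℕ x} {toℕ y} (λ y≡x → x≢y (toℕ-injective (sym y≡x)))
                 = ≤-trans (≤-reflexive (+-identityʳ _)) (b2n-≤1 (M x y))
    pointwise : ∀ j → b2n (ent M i j) + δ i j ≤ 1
    pointwise = ent-pred (λ i j m → b2n m + δ i j ≤ 1) δ-≤1 inside i

  ¬Excess-n : ∀ {M} → InS M → ¬ Excess M n
  ¬Excess-n noLoops excess = <⇒≱ excess (sumTo-≤-* (n ∸ 1) n λ _ → rowSum-≤-pred noLoops)

  Staircase : Mat n → Set
  Staircase A = ∀ (i j h k : Fin n) → A i j ≡ true → toℕ h ≤ toℕ i → toℕ k ≤ toℕ j → h ≢ k → A h k ≡ true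

  staircase-rowSum : ∀ {M} → Staircase M → ∀ {k i} → 1 ≤ k → k ≤ i → rowSum M i ≤ rowSum M k + 1
  staircase-rowSum {M} staircase {k} {i} 1≤k k≤i = begin
    rowSum M i                               ≤⟨ sumTo-mono-≤ n (λ j _ _ → pointwise j) ⟩
    sumTo (λ j → b2n (ent M k j) + δ k j) n  ≡⟨ sumTo-+ _ (δ k) n ⟩
    rowSum M k + sumTo (δ k) n               ≤⟨ +-monoʳ-≤ (rowSum M k) (sumTo-δ-≤1 k n) ⟩
    rowSum M k + 1                           ∎
    where
    open ≤-Reasoning
    pointwise : ∀ j → b2n (ent M i j) ≤ b2n (ent M k j) + δ k j
    pointwise j with ent-cases i j
    ... | inj₁ outside rewrite outside M = z≤n
    ... | inj₂ (x , y , refl , refl) with index-toℕ 1≤k (≤-trans k≤i (toℕ<n x))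
    ...   | x′ , refl rewrite ent-toℕ M x y | ent-toℕ M x′ y with x′ ≟ᶠ y
    ...     | yes refl rewrite δ-diag (toℕ x′) = ≤-trans (b2n-≤1 (M x x′)) (m≤n+m 1 _)
    ...     | no x′≢y rewrite δ-offdiag {toℕ x′} {toℕ y} (λ y≡x′ → x′≢y (toℕ-injective (sym y≡x′)))
                            | +-identityʳ (b2n (M x′ y))
            = b2n-mono λ Mxy → staircase x y x′ y Mxy (s≤s⁻¹ k≤i) ≤-refl x′≢y

  opposite-antitone : ∀ {x y : Fin n} → toℕ x ≤ toℕ y → toℕ (opposite y) ≤ toℕ (opposite x)
  opposite-antitone {x} {y} x≤y rewrite opposite-prop x | opposite-prop y = ∸-monoʳ-≤ n (s≤s x≤y)

  opposite-injective : ∀ {x y : Fin n} → opposite x ≡ opposite y → x ≡ y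
  opposite-injective {x} {y} eq = trans (sym (opposite-involutive x)) (trans (cong opposite eq) (opposite-involutive y))

  bar-diag : ∀ M (x : Fin n) → bar M x x ≡ false
  bar-diag M x with x ≟ᶠ x
  ... | yes _ = refl
  ... | no x≢x = contradiction refl x≢x

  bar-offdiag : ∀ M {x y : Fin n} → x ≢ y → bar M x y ≡ not (M (opposite y) (opposite x))
  bar-offdiag M {x} {y} x≢y with x ≟ᶠ y
  ... | yes x≡y = contradiction x≡y x≢y
  ... | no _ = refl

  bar-true⇒≢ : ∀ M {x y : Fin n} → bar M x y ≡ true → x ≢ y
  bar-true⇒≢ M {x} bar-xy refl with () ← trans (sym (bar-diag M x)) bar-xy

  bar-staircase : ∀ {A} → Staircase A → Staircase (bar A)
  bar-staircase {A} staircase i j h k bar-ij h≤i k≤j h≢k =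
    trans (bar-offdiag A h≢k) (cong not (¬-not A-kh≢true))
    where
    i≢j : i ≢ j
    i≢j = bar-true⇒≢ A bar-ij
    A-kh≢true : A (opposite k) (opposite h) ≢ true
    A-kh≢true A-kh with () ← trans (sym bar-ij) (trans (bar-offdiag A i≢j) (cong not
      (staircase (opposite k) (opposite h) (opposite j) (opposite i) A-kh
         (opposite-antitone k≤j) (opposite-antitone h≤i) (λ e → i≢j (sym (opposite-injective e))))))

module Peeling {n : ℕ} (m : ℕ) where
  open import Data.Bool using (true; false; not; _∧_; _∨_)
  open import Data.Bool.Properties using (¬-not; T-≡; T-∧; not-involutive; ∧-identityʳ; ∨-identityʳ; ∨-zeroʳ)
  open import Data.Nat
  open import Data.Nat.Properties
  open import Data.Nat.DivMod using (_%_; _/_; m≡m%n+[m/n]*n; m<n⇒m%n≡m; [m+kn]%n≡m%n)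
  open import Data.Fin using (Fin; toℕ; opposite)
  open import Data.Fin.Properties using (opposite-involutive) renaming (_≟_ to _≟ᶠ_)
  open import Data.Product using (_×_; _,_; proj₁; proj₂)
  open import Data.Sum using (inj₁; inj₂)
  open import Function using (_∘_)
  open import Function.Bundles using (module Equivalence)
  open import Relation.Nullary using (¬_; contradiction)
  open import Relation.Nullary.Decidable using (toSum)
  open import Relation.Binary.PropositionalEquality
  open FiniteSums
  open Matrices

  Front : ℕ → Fin n → Fin n → Set
  Front K x y = toℕ x < m × toℕ y * m + toℕ x < K

  front : ℕ → Mat n
  front K x y = (toℕ x <ᵇ m) ∧ (toℕ y * m + toℕ x <ᵇ K)

  front-sound : ∀ {K x y} → front K x y ≡ true → Front K x y
  front-sound {K} {x} {y} fr with Equivalence.to T-∧ (Equivalence.from T-≡ fr)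
  ... | x<m , idx<K = <ᵇ⇒< (toℕ x) m x<m , <ᵇ⇒< _ K idx<K

  front-complete : ∀ {K x y} → Front K x y → front K x y ≡ true
  front-complete (x<m , idx<K) = Equivalence.to T-≡ (Equivalence.from T-∧ (<⇒<ᵇ x<m , <⇒<ᵇ idx<K))

  front-false : ∀ {K x y} → ¬ Front K x y → front K x y ≡ false
  front-false {K} {x} {y} ¬front = ¬-not (λ fr → ¬front (front-sound {K} {x} {y} fr))

  front-downClosed : ∀ {K} x y {x′ y′} → toℕ x ≤ toℕ x′ → toℕ y ≤ toℕ y′ →
                     front K x′ y′ ≡ true → front K x y ≡ true
  front-downClosed {K} x y {x′} {y′} x≤x′ y≤y′ fr with front-sound {K} {x′} {y′} fr
  ... | x′<m , idx′<K =
    front-complete {K} {x} {y} (≤-<-trans x≤x′ x′<m , ≤-<-trans (+-mono-≤ (*-monoˡ-≤ m y≤y′) x≤x′) idx′<K)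

  front-step : .{{_ : NonZero m}} → ∀ {K x y} → front (suc K) x y ≡ true → front K x y ≡ false →
               toℕ x ≡ K % m × toℕ y ≡ K / m
  front-step {K} {x} {y} fr₁ fr₀ with front-sound {suc K} {x} {y} fr₁
  ... | x<m , idx<1+K = x≡K%m , *-cancelʳ-≡ (toℕ y) (K / m) m (+-cancelˡ-≡ (toℕ x) _ _ (begin
      toℕ x + toℕ y * m    ≡⟨ +-comm (toℕ x) _ ⟩
      toℕ y * m + toℕ x    ≡⟨ idx≡K ⟩
      K                    ≡⟨ m≡m%n+[m/n]*n K m ⟩
      K % m + K / m * m    ≡⟨ cong (_+ K / m * m) x≡K%m ⟨
      toℕ x + K / m * m    ∎))
    where
    open ≡-Reasoning
    idx≡K : toℕ y * m + toℕ x ≡ K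
    idx≡K = ≤-antisym (s≤s⁻¹ idx<1+K) (≮⇒≥ λ idx<K →
      contradiction (trans (sym fr₀) (front-complete {K} {x} {y} (x<m , idx<K))) λ ())
    x≡K%m : toℕ x ≡ K % m
    x≡K%m = begin
      toℕ x                    ≡⟨ m<n⇒m%n≡m x<m ⟨
      toℕ x % m                ≡⟨ [m+kn]%n≡m%n (toℕ x) (toℕ y) m ⟨
      (toℕ x + toℕ y * m) % m  ≡⟨ cong (_% m) (trans (+-comm (toℕ x) _) idx≡K) ⟩
      K % m                    ∎

  ∧-not-true : ∀ {a b} → a ∧ not b ≡ true → a ≡ true × b ≡ false
  ∧-not-true {true} {false} _ = refl , refl

  ∧-not-intro : ∀ {a b} → a ≡ true → b ≡ false → a ∧ not b ≡ true
  ∧-not-intro refl refl = refl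

  not-∧-not : ∀ a b → not (a ∧ not b) ≡ not a ∨ b
  not-∧-not true b = not-involutive b
  not-∧-not false b = refl

  peel : Mat n → ℕ → Mat n
  peel A K x y = A x y ∧ not (front K (opposite y) (opposite x))

  module _ {A : Mat n} where

    peel-⊆ : ∀ K → peel A K ⊆ A
    peel-⊆ K x y peeled = proj₁ (∧-not-true peeled)

    peel-InS : InS A → ∀ K → InS (peel A K)
    peel-InS noLoops K x rewrite noLoops x = refl

    peel-staircase : Staircase A → ∀ K → Staircase (peel A K)
    peel-staircase staircase K i j h k peeled h≤i k≤j h≢k with ∧-not-true peeled
    ... | A-ij , front-ji = ∧-not-intro (staircase i j h k A-ij h≤i k≤j h≢k) (¬-not λ front-kh →
      contradiction (trans (sym front-ji) (front-downClosed {K} (opposite j) (opposite i)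
                       (opposite-antitone k≤j) (opposite-antitone h≤i) front-kh)) λ ())

    peel-fixes : ∀ {K w} → K ≤ w * m → ∀ {x} → w ≤ toℕ (opposite x) → ∀ y → peel A K x y ≡ A x y
    peel-fixes {K} {w} K≤wm {x} w≤x̄ y =
      trans (cong (λ b → A x y ∧ not b) (front-false {K} {opposite y} {opposite x} (K≤idx ∘ proj₂))) (∧-identityʳ (A x y))
      where
      K≤idx : ¬ (toℕ (opposite x) * m + toℕ (opposite y) < K)
      K≤idx idx<K = <⇒≱ idx<K (≤-trans K≤wm (≤-trans (*-monoˡ-≤ m w≤x̄) (m≤m+n _ _)))

    bar-peel : ∀ K {x y} → x ≢ y → bar (peel A K) x y ≡ bar A x y ∨ front K x y
    bar-peel K {x} {y} x≢y = begin
      bar (peel A K) x y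
        ≡⟨ bar-offdiag (peel A K) x≢y ⟩
      not (A (opposite y) (opposite x) ∧ not (front K (opposite (opposite x)) (opposite (opposite y))))
        ≡⟨ cong₂ (λ x′ y′ → not (A (opposite y) (opposite x) ∧ not (front K x′ y′))) (opposite-involutive x) (opposite-involutive y) ⟩
      not (A (opposite y) (opposite x) ∧ not (front K x y))
        ≡⟨ not-∧-not (A (opposite y) (opposite x)) (front K x y) ⟩
      not (A (opposite y) (opposite x)) ∨ front K x y
        ≡⟨ cong (_∨ front K x y) (bar-offdiag A x≢y) ⟨
      bar A x y ∨ front K x y
        ∎
      where open ≡-Reasoning

    bar-⊆-bar-peel : ∀ K → bar A ⊆ bar (peel A K)
    bar-⊆-bar-peel K x y bar-xy = trans (bar-peel K (bar-true⇒≢ A bar-xy)) (cong (_∨ front K x y) bar-xy)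

    bar-peel-outside : ∀ K x y → ¬ Front K x y → bar (peel A K) x y ≡ bar A x y
    bar-peel-outside K x y ¬front with toSum (x ≟ᶠ y)
    ... | inj₁ refl = trans (bar-diag (peel A K) x) (sym (bar-diag A x))
    ... | inj₂ x≢y = trans (bar-peel K x≢y) (trans (cong (bar A x y ∨_) (front-false {K} {x} {y} ¬front)) (∨-identityʳ _))

    bar-peel-full : ∀ {w x y} → toℕ x < m → toℕ y < w → x ≢ y → bar (peel A (w * m)) x y ≡ true
    bar-peel-full {w} {x} {y} x<m y<w x≢y = trans (bar-peel (w * m) x≢y)
      (trans (cong (bar A x y ∨_) (front-complete {w * m} {x} {y} (x<m , idx<wm))) (∨-zeroʳ _))
      where
      idx<wm : toℕ y * m + toℕ x < w * m
      idx<wm = ≤-trans (+-monoʳ-< (toℕ y * m) x<m) (≤-trans (≤-reflexive (+-comm (toℕ y * m) m)) (*-monoˡ-≤ m y<w))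

    bar-peel-step : .{{_ : NonZero m}} → ∀ K x y →
      b2n (bar (peel A (suc K)) x y) ≤ b2n (bar (peel A K) x y) + δ (K % m) (toℕ x) * δ (K / m) (toℕ y)
    bar-peel-step K x y with toSum (x ≟ᶠ y)
    ... | inj₁ refl rewrite bar-diag (peel A (suc K)) x = z≤n
    ... | inj₂ x≢y rewrite bar-peel (suc K) x≢y | bar-peel K x≢y
      with bar A x y | front (suc K) x y in front₁ | front K x y in front₀
    ...   | true  | _     | _     = s≤s z≤n
    ...   | false | false | _     = z≤n
    ...   | false | true  | true  = s≤s z≤n
    ...   | false | true  | false with front-step {K} {x} {y} front₁ front₀
    ...     | x≡K%m , y≡K/m rewrite sym x≡K%m | sym y≡K/m | δ-diag (toℕ x) | δ-diag (toℕ y) = ≤-refl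

module QuadraticRoots where
  open import Data.Nat
  open import Data.Nat.Properties
  open import Data.Nat.Tactic.RingSolver using (solve-∀)
  open import Data.Product using (∃; ∃₂; _×_; _,_)
  open import Data.Sum using (_⊎_; inj₁; inj₂)
  open import Relation.Nullary using (¬_)
  open import Relation.Binary.PropositionalEquality
  open Crossings

  -- r² (z² + u z) at z = p / r
  quad : ℕ → ℕ → ℕ → ℕ
  quad r u p = u * p * r + p * p

  quad-suc : ∀ r u p → quad r u (suc p) ≡ quad r u p + (u * r + 2 * p + 1)
  quad-suc = expand
    where
    expand : ∀ r u p → u * suc p * r + suc p * suc p ≡ (u * p * r + p * p) + (u * r + 2 * p + 1)
    expand = solve-∀

  quad-suc-coeff : ∀ r u p → quad r (suc u) p ≡ quad r u p + p * r
  quad-suc-coeff = expand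
    where
    expand : ∀ r u p → suc u * p * r + p * p ≡ (u * p * r + p * p) + p * r
    expand = solve-∀

  quad-monoˡ-≤ : ∀ r {u u′} p → u′ ≤ u → quad r u′ p ≤ quad r u p
  quad-monoˡ-≤ r p u′≤u = +-monoˡ-≤ (p * p) (*-monoˡ-≤ r (*-monoˡ-≤ p u′≤u))

  quad-≤ : ∀ {r} u {p} → p ≤ r → quad r u p ≤ suc u * p * r
  quad-≤ {r} u {p} p≤r = begin
    u * p * r + p * p  ≤⟨ +-monoʳ-≤ (u * p * r) (*-monoʳ-≤ p p≤r) ⟩
    u * p * r + p * r  ≡⟨ expand r u p ⟩
    suc u * p * r      ∎
    where
    open ≤-Reasoning
    expand : ∀ r u p → u * p * r + p * r ≡ suc u * p * r
    expand = solve-∀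

  2p+1<2r : ∀ {p r} → p < r → 2 * p + 1 < 2 * r
  2p+1<2r {p} {r} p<r = begin-strict
    2 * p + 1       <⟨ n<1+n _ ⟩
    suc (2 * p + 1) ≡⟨ expand p ⟩
    2 * suc p       ≤⟨ *-monoʳ-≤ 2 p<r ⟩
    2 * r           ∎
    where
    open ≤-Reasoning
    expand : ∀ p → suc (2 * p + 1) ≡ 2 * suc p
    expand = solve-∀

  module _ {u s r p} (p<r : p < r) (below : quad r u p ≤ s * (r * r)) where

    private
      increment<ur+2r : u * r + 2 * p + 1 < (u + 2) * r
      increment<ur+2r = begin-strict
        u * r + 2 * p + 1   ≡⟨ +-assoc (u * r) (2 * p) 1 ⟩
        u * r + (2 * p + 1) <⟨ +-monoʳ-< (u * r) (2p+1<2r p<r) ⟩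
        u * r + 2 * r       ≡⟨ *-distribʳ-+ r u 2 ⟨
        (u + 2) * r         ∎
        where open ≤-Reasoning

      quad-suc≤ : quad r u (suc p) ≤ s * (r * r) + (u * r + 2 * p + 1)
      quad-suc≤ = ≤-trans (≤-reflexive (quad-suc r u p)) (+-monoˡ-≤ _ below)

    quad-below-larger-s : ∀ {u′ s′} → u + 2 ≤ r → u′ ≤ u → s < s′ → quad r u′ (suc p) < s′ * (r * r)
    quad-below-larger-s {u′} {s′} u+2≤r u′≤u s<s′ = begin-strict
      quad r u′ (suc p)                    ≤⟨ quad-monoˡ-≤ r (suc p) u′≤u ⟩
      quad r u (suc p)                     ≤⟨ quad-suc≤ ⟩
      s * (r * r) + (u * r + 2 * p + 1)    <⟨ +-monoʳ-< (s * (r * r)) (<-≤-trans increment<ur+2r (*-monoˡ-≤ r u+2≤r)) ⟩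
      s * (r * r) + r * r                  ≡⟨ +-comm (s * (r * r)) (r * r) ⟩
      suc s * (r * r)                      ≤⟨ *-monoˡ-≤ (r * r) s<s′ ⟩
      s′ * (r * r)                         ∎
      where open ≤-Reasoning

    quad-below-smaller-u : ∀ {u′ s′} → u + 2 ≤ suc p → u′ < u → s ≤ s′ → quad r u′ (suc p) < s′ * (r * r)
    quad-below-smaller-u {u′} {s′} u+2≤1+p u′<u s≤s′ = <-≤-trans (+-cancelʳ-< (suc p * r) _ _ (begin-strict
      quad r u′ (suc p) + suc p * r        ≡⟨ quad-suc-coeff r u′ (suc p) ⟨
      quad r (suc u′) (suc p)              ≤⟨ quad-monoˡ-≤ r (suc p) u′<u ⟩
      quad r u (suc p)                     ≤⟨ quad-suc≤ ⟩
      s * (r * r) + (u * r + 2 * p + 1)    <⟨ +-monoʳ-< (s * (r * r)) (<-≤-trans increment<ur+2r (*-monoˡ-≤ r u+2≤1+p)) ⟩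
      s * (r * r) + suc p * r              ∎)) (*-monoˡ-≤ (r * r) s≤s′)
      where open ≤-Reasoning

  quad-at-r : ∀ {r u s} .{{_ : NonZero r}} → s ≤ u → s * (r * r) < quad r u r
  quad-at-r {r} {u} {s} s≤u = begin-strict
    s * (r * r)      <⟨ *-monoˡ-< (r * r) {{m*n≢0 r r}} (s≤s s≤u) ⟩
    suc u * (r * r)  ≡⟨ expand u r ⟩
    quad r u r       ∎
    where
    open ≤-Reasoning
    expand : ∀ u r → suc u * (r * r) ≡ u * r * r + r * r
    expand = solve-∀

  r<numerator : ∀ {r u s p} → 1 ≤ s → p ≤ r → s * (r * r) < quad r u p → r < suc u * p
  r<numerator {r} {u} {s} {p} 1≤s p≤r above = *-cancelʳ-< r r (suc u * p) (begin-strict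
    r * r          ≤⟨ m≤n*m (r * r) s {{>-nonZero 1≤s}} ⟩
    s * (r * r)    <⟨ above ⟩
    quad r u p     ≤⟨ quad-≤ u p≤r ⟩
    suc u * p * r  ∎)
    where open ≤-Reasoning

  -- The positive root z(u, s) of z² + u z = s is increasing in s and decreasing in u. Between z(u, s)
  -- and a larger z(u′, s′) lies p / r, where r = (u + 1)(u + 3) and p is the least numerator with
  -- p / r > z(u, s); this r makes p / r close enough to z(u, s) for both kinds of increase.
  fraction-between : ∀ {u s u′ s′} → 1 ≤ s → s ≤ u → (s < s′ × u′ ≤ u) ⊎ (u′ < u × s ≤ s′) →
    ∃₂ λ p r → 1 ≤ r × s * (r * r) < quad r u p × quad r u′ p < s′ * (r * r)
  fraction-between {u} {s} {u′} {s′} 1≤s s≤u increase =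
    least-above (first-crossing (λ p → s * (r * r) <? quad r u p) ¬above-0 (quad-at-r s≤u))
    where
    r : ℕ
    r = suc u * (3 + u)
    ¬above-0 : ¬ (s * (r * r) < quad r u 0)
    ¬above-0 rewrite *-zeroʳ u = n≮0
    u+2≤3+u : u + 2 ≤ 3 + u
    u+2≤3+u = ≤-trans (≤-reflexive (+-comm u 2)) (n≤1+n _)
    least-above : (∃ λ p → suc p ≤ r × ¬ (s * (r * r) < quad r u p) × s * (r * r) < quad r u (suc p)) →
                  ∃₂ λ p r → 1 ≤ r × s * (r * r) < quad r u p × quad r u′ p < s′ * (r * r)
    least-above (p , 1+p≤r , ¬above-p , above-1+p) = suc p , r , s≤s z≤n , above-1+p , below increase
      where
      below : (s < s′ × u′ ≤ u) ⊎ (u′ < u × s ≤ s′) → quad r u′ (suc p) < s′ * (r * r)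
      below (inj₁ (s<s′ , u′≤u)) =
        quad-below-larger-s 1+p≤r (≮⇒≥ ¬above-p) (≤-trans u+2≤3+u (m≤n*m (3 + u) (suc u))) u′≤u s<s′
      below (inj₂ (u′<u , s≤s′)) =
        quad-below-smaller-u 1+p≤r (≮⇒≥ ¬above-p)
          (≤-trans u+2≤3+u (<⇒≤ (*-cancelˡ-< (suc u) (3 + u) (suc p) (r<numerator {u = u} 1≤s 1+p≤r above-1+p)))) u′<u s≤s′

module Surds where
  open import Data.Nat
  open import Data.Nat.Properties
  open import Data.Nat.Tactic.RingSolver using () renaming (solve-∀ to ℕ-solve-∀)
  open import Data.Integer as ℤ using (ℤ; +_)
  import Data.Integer.Properties as ℤ
  open import Data.Integer.Tactic.RingSolver using (solve-∀)
  open import Data.Rational as ℚ using (ℚ; toℚᵘ; fromℚᵘ)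
  import Data.Rational.Properties as ℚ
  open import Data.Rational.Unnormalised as ℚᵘ using (mkℚᵘ; *<*; *≡*)
  import Data.Rational.Unnormalised.Properties as ℚᵘ
  open import Data.Product using (∃₂; _×_; _,_)
  open import Data.Sum using (_⊎_; inj₁; inj₂)
  open import Relation.Nullary using (¬_)
  open import Relation.Binary.PropositionalEquality
  open QuadraticRoots

  frac : ℤ → ℕ → ℚ
  frac N r′ = fromℚᵘ (mkℚᵘ N r′)

  2frac-≃ : ∀ N a r′ → toℚᵘ (ℤtoℚ (+ 2) ℚ.* frac N r′ ℚ.- ℤtoℚ a) ℚᵘ.≃ mkℚᵘ (+ 2 ℤ.* N ℤ.- a ℤ.* + suc r′) r′
  2frac-≃ N a r′ = begin-equality
    toℚᵘ (ℤtoℚ (+ 2) ℚ.* frac N r′ ℚ.- ℤtoℚ a)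
      ≃⟨ ℚ.toℚᵘ-homo-+ (ℤtoℚ (+ 2) ℚ.* frac N r′) (ℚ.- ℤtoℚ a) ⟩
    toℚᵘ (ℤtoℚ (+ 2) ℚ.* frac N r′) ℚᵘ.+ toℚᵘ (ℚ.- ℤtoℚ a)
      ≃⟨ ℚᵘ.+-cong (ℚ.toℚᵘ-homo-* (ℤtoℚ (+ 2)) (frac N r′)) (ℚ.toℚᵘ-homo‿- (ℤtoℚ a)) ⟩
    toℚᵘ (ℤtoℚ (+ 2)) ℚᵘ.* toℚᵘ (frac N r′) ℚᵘ.+ ℚᵘ.- toℚᵘ (ℤtoℚ a)
      ≃⟨ ℚᵘ.+-cong (ℚᵘ.*-cong (ℚ.toℚᵘ-fromℚᵘ (mkℚᵘ (+ 2) 0)) (ℚ.toℚᵘ-fromℚᵘ (mkℚᵘ N r′)))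
                  (ℚᵘ.-‿cong (ℚ.toℚᵘ-fromℚᵘ (mkℚᵘ a 0))) ⟩
    mkℚᵘ (+ 2) 0 ℚᵘ.* mkℚᵘ N r′ ℚᵘ.+ ℚᵘ.- mkℚᵘ a 0
      ≃⟨ *≡* (cross-multiplied N a r′) ⟩
    mkℚᵘ (+ 2 ℤ.* N ℤ.- a ℤ.* + suc r′) r′
      ∎
    where
    open ℚᵘ.≤-Reasoning
    cross-multiplied : ∀ N a r′ → ((+ 2 ℤ.* N) ℤ.* + 1 ℤ.+ (ℤ.- a) ℤ.* + suc (r′ + 0)) ℤ.* + suc r′
                                  ≡ (+ 2 ℤ.* N ℤ.- a ℤ.* + suc r′) ℤ.* + (suc (r′ + 0) * 1)
    cross-multiplied N a r′ rewrite +-identityʳ r′ | *-identityʳ (suc r′) = ring N a (+ suc r′)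
      where
      ring : ∀ N a R → ((+ 2 ℤ.* N) ℤ.* + 1 ℤ.+ (ℤ.- a) ℤ.* R) ℤ.* R ≡ (+ 2 ℤ.* N ℤ.- a ℤ.* R) ℤ.* R
      ring = solve-∀

  module _ {x : ℚ} {T : ℕ} (r′ : ℕ) (x≃T/r : toℚᵘ x ℚᵘ.≃ mkℚᵘ (+ T) r′) where

    private
      r : ℕ
      r = suc r′
      x²≃T²/r² : toℚᵘ (x ℚ.* x) ℚᵘ.≃ mkℚᵘ (+ T ℤ.* + T) (r′ + r′ * r)
      x²≃T²/r² = ℚᵘ.≃-trans (ℚ.toℚᵘ-homo-* x x) (ℚᵘ.*-cong x≃T/r x≃T/r)
      T²≡T²*1 : + (T * T) ≡ (+ T ℤ.* + T) ℤ.* + 1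
      T²≡T²*1 = trans (ℤ.pos-* T T) (sym (ℤ.*-identityʳ _))

    sqrt<ℚ-frac : ∀ {D} → D * (r * r) < T * T → sqrt<ℚ D x
    sqrt<ℚ-frac {D} D*r²<T² = ℚ.toℚᵘ-cancel-< 0<x , ℚ.toℚᵘ-cancel-< D<x²
      where
      open ℚᵘ.≤-Reasoning
      0<T : 0 < T
      0<T = n≢0⇒n>0 λ { refl → n≮0 D*r²<T² }
      0<x : toℚᵘ ℚ.0ℚ ℚᵘ.< toℚᵘ x
      0<x = begin-strict
        mkℚᵘ (+ 0) 0  <⟨ *<* (subst (+ 0 ℤ.<_) (sym (ℤ.*-identityʳ (+ T))) (ℤ.+<+ 0<T)) ⟩
        mkℚᵘ (+ T) r′ ≃⟨ ℚᵘ.≃-sym x≃T/r ⟩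
        toℚᵘ x        ∎
      D<x² : toℚᵘ (ℤtoℚ (+ D)) ℚᵘ.< toℚᵘ (x ℚ.* x)
      D<x² = begin-strict
        toℚᵘ (ℤtoℚ (+ D))                       ≃⟨ ℚ.toℚᵘ-fromℚᵘ (mkℚᵘ (+ D) 0) ⟩
        mkℚᵘ (+ D) 0                            <⟨ *<* (subst₂ ℤ._<_ (ℤ.pos-* D (r * r)) T²≡T²*1 (ℤ.+<+ D*r²<T²)) ⟩
        mkℚᵘ (+ T ℤ.* + T) (r′ + r′ * r)    ≃⟨ ℚᵘ.≃-sym x²≃T²/r² ⟩
        toℚᵘ (x ℚ.* x)                          ∎

    ℚ<sqrt-frac : ∀ {D} → T * T < D * (r * r) → ℚ<sqrt x D
    ℚ<sqrt-frac {D} T²<D*r² = inj₂ (ℚ.toℚᵘ-cancel-< (begin-strict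
        toℚᵘ (x ℚ.* x)                          ≃⟨ x²≃T²/r² ⟩
        mkℚᵘ (+ T ℤ.* + T) (r′ + r′ * r)    <⟨ *<* (subst₂ ℤ._<_ T²≡T²*1 (ℤ.pos-* D (r * r)) (ℤ.+<+ T²<D*r²)) ⟩
        mkℚᵘ (+ D) 0                            ≃⟨ ℚᵘ.≃-sym (ℚ.toℚᵘ-fromℚᵘ (mkℚᵘ (+ D) 0)) ⟩
        toℚᵘ (ℤtoℚ (+ D))                       ∎))
      where open ℚᵘ.≤-Reasoning

  surd-<ᵣ : ∀ {a a′ D D′ T T′} N r′ →
            + 2 ℤ.* N ℤ.- a ℤ.* + suc r′ ≡ + T → + 2 ℤ.* N ℤ.- a′ ℤ.* + suc r′ ≡ + T′ →
            D * (suc r′ * suc r′) < T * T → T′ * T′ < D′ * (suc r′ * suc r′) →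
            surd a D <ᵣ surd a′ D′
  surd-<ᵣ {a} {a′} {D} {D′} N r′ T≡ T′≡ D*r²<T² T′²<D′*r² =
    frac N r′ , sqrt<ℚ-frac r′ (≃T/r a T≡) {D} D*r²<T² , ℚ<sqrt-frac r′ (≃T/r a′ T′≡) {D′} T′²<D′*r²
    where
    ≃T/r : ∀ a {T} → + 2 ℤ.* N ℤ.- a ℤ.* + suc r′ ≡ T →
           toℚᵘ (ℤtoℚ (+ 2) ℚ.* frac N r′ ℚ.- ℤtoℚ a) ℚᵘ.≃ mkℚᵘ T r′
    ≃T/r a T≡ = subst (λ T → toℚᵘ _ ℚᵘ.≃ mkℚᵘ T r′) T≡ (2frac-≃ N a r′)

  φ′ : ℕ → ℕ → ℕ → Surd
  φ′ c v s = surd (+ v ℤ.- + 1) (ℤ.∣ t ∣ * ℤ.∣ t ∣ + 4 * s)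
    where
    t : ℤ
    t = + (2 * c) ℤ.- + v ℤ.- + 1

  module _ {c v u : ℕ} (2c≡v+1+u : 2 * c ≡ v + 1 + u) where

    2c-v-1≡u : + (2 * c) ℤ.- + v ℤ.- + 1 ≡ + u
    2c-v-1≡u = begin
      + (2 * c) ℤ.- + v ℤ.- + 1         ≡⟨ cong (λ z → z ℤ.- + v ℤ.- + 1) (trans (cong +_ 2c≡v+1+u) (ℤ.pos-+ (v + 1) u)) ⟩
      + (v + 1) ℤ.+ + u ℤ.- + v ℤ.- + 1  ≡⟨ cong (λ z → z ℤ.+ + u ℤ.- + v ℤ.- + 1) (ℤ.pos-+ v 1) ⟩
      + v ℤ.+ + 1 ℤ.+ + u ℤ.- + v ℤ.- + 1  ≡⟨ ring (+ v) (+ u) ⟩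
      + u                                  ∎
      where
      open ≡-Reasoning
      ring : ∀ V U → V ℤ.+ + 1 ℤ.+ U ℤ.- V ℤ.- + 1 ≡ U
      ring = solve-∀

    φ′≡ : ∀ s → φ′ c v s ≡ surd (+ v ℤ.- + 1) (u * u + 4 * s)
    φ′≡ s = cong (λ t → surd (+ v ℤ.- + 1) (ℤ.∣ t ∣ * ℤ.∣ t ∣ + 4 * s)) 2c-v-1≡u

    -- With q = c - 1 + p / r we have 2 q - (v - 1) = u + 2 p / r.
    2N-ar≡ : ∀ r p → + 2 ℤ.* ((+ c ℤ.- + 1) ℤ.* + r ℤ.+ + p) ℤ.- (+ v ℤ.- + 1) ℤ.* + r ≡ + (u * r + 2 * p)
    2N-ar≡ r p = begin
      + 2 ℤ.* ((+ c ℤ.- + 1) ℤ.* + r ℤ.+ + p) ℤ.- (+ v ℤ.- + 1) ℤ.* + r ≡⟨ ring (+ c) (+ v) (+ r) (+ p) ⟩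
      (+ 2 ℤ.* + c ℤ.- + v ℤ.- + 1) ℤ.* + r ℤ.+ + 2 ℤ.* + p            ≡⟨ cong (λ z → (z ℤ.- + v ℤ.- + 1) ℤ.* + r ℤ.+ + 2 ℤ.* + p) (ℤ.pos-* 2 c) ⟨
      (+ (2 * c) ℤ.- + v ℤ.- + 1) ℤ.* + r ℤ.+ + 2 ℤ.* + p            ≡⟨ cong (λ z → z ℤ.* + r ℤ.+ + 2 ℤ.* + p) 2c-v-1≡u ⟩
      + u ℤ.* + r ℤ.+ + 2 ℤ.* + p                                      ≡⟨ cong₂ ℤ._+_ (ℤ.pos-* u r) (ℤ.pos-* 2 p) ⟨
      + (u * r) ℤ.+ + (2 * p)                                      ≡⟨ ℤ.pos-+ (u * r) (2 * p) ⟨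
      + (u * r + 2 * p)                                          ∎
      where
      open ≡-Reasoning
      ring : ∀ C V R P → + 2 ℤ.* ((C ℤ.- + 1) ℤ.* R ℤ.+ P) ℤ.- (V ℤ.- + 1) ℤ.* R
                         ≡ (+ 2 ℤ.* C ℤ.- V ℤ.- + 1) ℤ.* R ℤ.+ + 2 ℤ.* P
      ring = solve-∀

  module _ (r u p s : ℕ) where

    private
      expand-T² : (u * r + 2 * p) * (u * r + 2 * p) ≡ u * u * (r * r) + 4 * quad r u p
      expand-T² = expand r u p
        where
        expand : ∀ r u p → (u * r + 2 * p) * (u * r + 2 * p) ≡ u * u * (r * r) + 4 * (u * p * r + p * p)
        expand = ℕ-solve-∀
      expand-D : (u * u + 4 * s) * (r * r) ≡ u * u * (r * r) + 4 * (s * (r * r))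
      expand-D = expand r u s
        where
        expand : ∀ r u s → (u * u + 4 * s) * (r * r) ≡ u * u * (r * r) + 4 * (s * (r * r))
        expand = ℕ-solve-∀

    -- completing the square: (u r + 2 p)² - (u² + 4 s) r² = 4 (quad r u p - s r²)
    square-above : s * (r * r) < quad r u p →
                   (u * u + 4 * s) * (r * r) < (u * r + 2 * p) * (u * r + 2 * p)
    square-above above = subst₂ _<_ (sym expand-D) (sym expand-T²) (+-monoʳ-< (u * u * (r * r)) (*-monoʳ-< 4 above))

    square-below : quad r u p < s * (r * r) →
                   (u * r + 2 * p) * (u * r + 2 * p) < (u * u + 4 * s) * (r * r)
    square-below below = subst₂ _<_ (sym expand-T²) (sym expand-D) (+-monoʳ-< (u * u * (r * r)) (*-monoʳ-< 4 below))


  surd-<ᵣ-at-fraction : ∀ {c v u s v′ u′ s′} → 2 * c ≡ v + 1 + u → 2 * c ≡ v′ + 1 + u′ → ∀ r′ p →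
    s * (suc r′ * suc r′) < quad (suc r′) u p → quad (suc r′) u′ p < s′ * (suc r′ * suc r′) →
    surd (+ v ℤ.- + 1) (u * u + 4 * s) <ᵣ surd (+ v′ ℤ.- + 1) (u′ * u′ + 4 * s′)
  surd-<ᵣ-at-fraction {c} {v} {u} {s} {v′} {u′} {s′} eq eq′ r′ p above below =
      surd-<ᵣ {+ v ℤ.- + 1} {+ v′ ℤ.- + 1} {u * u + 4 * s} {u′ * u′ + 4 * s′}
         ((+ c ℤ.- + 1) ℤ.* + suc r′ ℤ.+ + p) r′
         (2N-ar≡ {c} {v} {u} eq (suc r′) p) (2N-ar≡ {c} {v′} {u′} eq′ (suc r′) p)
         (square-above (suc r′) u p s above) (square-below (suc r′) u′ p s′ below)

  φ′-<ᵣ : ∀ {c v u s v′ u′ s′} → 2 * c ≡ v + 1 + u → 2 * c ≡ v′ + 1 + u′ → 1 ≤ s → s ≤ u →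
          (s < s′ × u′ ≤ u) ⊎ (u′ < u × s ≤ s′) → φ′ c v s <ᵣ φ′ c v′ s′
  φ′-<ᵣ {c} {v} {u} {s} {v′} {u′} {s′} eq eq′ 1≤s s≤u increase = through (fraction-between 1≤s s≤u increase)
    where
    through : (∃₂ λ p r → 1 ≤ r × s * (r * r) < quad r u p × quad r u′ p < s′ * (r * r)) →
              φ′ c v s <ᵣ φ′ c v′ s′
    through (p , suc r′ , _ , above , below) =
      subst₂ _<ᵣ_ (sym (φ′≡ {c} {v} {u} eq s)) (sym (φ′≡ {c} {v′} {u′} eq′ s′))
        (surd-<ᵣ-at-fraction {c} {v} {u} {s} {v′} {u′} {s′} eq eq′ r′ p above below)

  φ′-strictMono : ∀ {c v s v′ s′} → 1 ≤ s → v + s < 2 * c → v′ + s′ ≤ 2 * c →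
                  v ≤ v′ → s ≤ s′ → v + s < v′ + s′ → φ′ c v s <ᵣ φ′ c v′ s′
  φ′-strictMono {c} {v} {s} {v′} {s′} 1≤s v+s<2c v′+s′≤2c v≤v′ s≤s′ v+s<v′+s′ =
    φ′-<ᵣ {c} {v} {2 * c ∸ (v + 1)} {s} {v′} {2 * c ∸ (v′ + 1)} {s′}
      (sym (m+[n∸m]≡n v+1≤2c)) (sym (m+[n∸m]≡n v′+1≤2c)) 1≤s s≤u increase
    where
    v+1≤2c : v + 1 ≤ 2 * c
    v+1≤2c = ≤-trans (+-monoʳ-≤ v 1≤s) (<⇒≤ v+s<2c)
    v′+1≤2c : v′ + 1 ≤ 2 * c
    v′+1≤2c = ≤-trans (+-monoʳ-≤ v′ (≤-trans 1≤s s≤s′)) v′+s′≤2c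
    s≤u : s ≤ 2 * c ∸ (v + 1)
    s≤u = m+n≤o⇒m≤o∸n s (subst (_≤ 2 * c) (reorder v s) v+s<2c)
      where
      reorder : ∀ v s → suc (v + s) ≡ s + (v + 1)
      reorder = ℕ-solve-∀
    increase : (s < s′ × 2 * c ∸ (v′ + 1) ≤ 2 * c ∸ (v + 1))
             ⊎ (2 * c ∸ (v′ + 1) < 2 * c ∸ (v + 1) × s ≤ s′)
    increase with m≤n⇒m<n∨m≡n v≤v′
    ... | inj₁ v<v′ = inj₂ (∸-monoʳ-< (+-monoˡ-< 1 v<v′) v′+1≤2c , s≤s′)
    ... | inj₂ refl = inj₁ (+-cancelˡ-< v s s′ v+s<v′+s′ , ≤-refl)

  <ᵣ-irrefl : ∀ x → ¬ (x <ᵣ x)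
  <ᵣ-irrefl (surd a D) (q , (0<x , D<x²) , inj₁ x<0) = ℚ.<-asym 0<x x<0
  <ᵣ-irrefl (surd a D) (q , (0<x , D<x²) , inj₂ x²<D) = ℚ.<-asym D<x² x²<D

  ≈ᵣ-reflexive : ∀ {x y} → x ≡ y → x ≈ᵣ y
  ≈ᵣ-reflexive {x} refl = <ᵣ-irrefl x , <ᵣ-irrefl x

module IntegerArithmetic where
  open import Data.Nat
  open import Data.Nat.Properties
  open import Data.Integer as ℤ using (+_)
  import Data.Integer.Properties as ℤ
  open import Data.Integer.Tactic.RingSolver using (solve-∀)
  open import Relation.Binary.PropositionalEquality

  +-∸ : ∀ {a b} → b ≤ a → + a ℤ.- + b ≡ + (a ∸ b)
  +-∸ {a} {b} b≤a = trans (ℤ.m-n≡m⊖n a b) (ℤ.⊖-≥ b≤a)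

  ⊓-∸ : ∀ {a b k l} → b ≤ a → l < k → (+ a ℤ.- + b) ℤ.⊓ (+ k ℤ.- + l ℤ.- + 1) ≡ + ((a ∸ b) ⊓ (k ∸ suc l))
  ⊓-∸ {a} {b} {k} {l} b≤a l<k = cong₂ ℤ._⊓_ (+-∸ b≤a) (begin
    + k ℤ.- + l ℤ.- + 1  ≡⟨ cong (ℤ._- + 1) (+-∸ (<⇒≤ l<k)) ⟩
    + (k ∸ l) ℤ.- + 1    ≡⟨ +-∸ (m<n⇒0<n∸m l<k) ⟩
    + (k ∸ l ∸ 1)        ≡⟨ cong +_ (trans (∸-+-assoc k l 1) (cong (k ∸_) (+-comm l 1))) ⟩
    + (k ∸ suc l)        ∎)
    where open ≡-Reasoning

  <-∸⇒+< : ∀ {i j} b → i ℤ.< j ℤ.- + b → i ℤ.+ + b ℤ.< j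
  <-∸⇒+< {i} {j} b i<j-b = subst (i ℤ.+ + b ℤ.<_) (cancel j (+ b)) (ℤ.+-monoˡ-< (+ b) i<j-b)
    where
    cancel : ∀ j b → j ℤ.- b ℤ.+ b ≡ j
    cancel = solve-∀

  +<-∸⇒+< : ∀ {x a} b → + x ℤ.< + a ℤ.- + b → x + b < a
  +<-∸⇒+< {x} {a} b x<a-b = ℤ.drop‿+<+ (subst (ℤ._< + a) (sym (ℤ.pos-+ x b)) (<-∸⇒+< b x<a-b))

  +<-∸-∸⇒+< : ∀ {x a b} → + x ℤ.< + a ℤ.- + b ℤ.- + 1 → x + 1 + b < a
  +<-∸-∸⇒+< {x} {a} {b} x<a-b-1 = +<-∸⇒+< b (subst (ℤ._< + a ℤ.- + b) (sym (ℤ.pos-+ x 1)) (<-∸⇒+< 1 x<a-b-1))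

module Construction {n : ℕ} (3≤n : 3 ≤ n) (A : Mat n) (A∈𝒮* : InSStar A)
  (n≤c+c̄ : n ≤ cOf A + cOf (bar A))
  (v̄+s̄<2c̄ : vOf (bar A) + sOf (bar A) ℕ.< 2 * cOf (bar A))
  (v̄+1+c<n : vOf (bar A) + 1 + cOf A ℕ.< n) where

  open import Data.Bool using (true; false)
  open import Data.Bool.Properties using (¬-not)
  open import Data.Nat
  open import Data.Nat.Properties
  open import Data.Integer as ℤ using (+_)
  open import Data.Fin using (Fin; toℕ; fromℕ<)
  open import Data.Fin.Properties using (toℕ-fromℕ<; opposite-prop)
  open import Data.Product using (∃; _×_; _,_; proj₁; proj₂)
  open import Data.Sum using (_⊎_; inj₁; inj₂; [_,_])
  open import Function using (_∘_)
  open import Relation.Nullary using (¬_; contradiction; _⊎-dec_)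
  open import Relation.Binary.PropositionalEquality hiding ([_])
  open Crossings
  open FiniteSums
  open MaximalExcess
  open Matrices
  open Surds
  open IntegerArithmetic

  B : Mat n
  B = bar A

  c c̄ v̄ s̄ m w : ℕ
  c = cOf A
  c̄ = cOf B
  v̄ = vOf B
  s̄ = sOf B
  m = suc c̄
  w = n ∸ suc c

  open Peeling {n} m

  private
    A-noLoops : InS A
    A-noLoops = proj₁ A∈𝒮*
    A-staircase : Staircase A
    A-staircase = proj₂ (proj₂ (proj₂ (proj₂ (proj₂ A∈𝒮*))))

  1≤c : 1 ≤ c
  1≤c = ≮⇒≥ λ c<1 → cSearch-maximal A n c<1 (≤-trans (s≤s z≤n) 3≤n) excess-1
    where
    excess-1 : Excess A 1
    excess-1 = ≤-trans (≤-reflexive (cong b2n (sym (proj₁ (proj₂ A∈𝒮*)))))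
                       (term≤sumTo (λ j → b2n (ent A 1 j)) (s≤s z≤n) (≤-trans (s≤s (s≤s z≤n)) 3≤n))

  c<n : c < n
  c<n = ≤-trans (s≤s (m≤n+m c (v̄ + 1))) v̄+1+c<n

  v̄<w : v̄ < w
  v̄<w = +-cancelʳ-< (suc c) v̄ w (subst₂ _<_ (+-assoc v̄ 1 c) (sym (m∸n+n≡m c<n)) v̄+1+c<n)

  w<c̄ : w < c̄
  w<c̄ = +-cancelʳ-≤ c (suc w) c̄ (subst₂ _≤_ (trans (sym (m∸n+n≡m c<n)) (+-suc w c)) (+-comm c c̄) n≤c+c̄)

  1≤c̄ : 1 ≤ c̄
  1≤c̄ = ≤-trans (s≤s z≤n) w<c̄

  excess-B : Excess B c̄
  excess-B = cOf-excess B 1≤c̄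

  1≤s̄ : 1 ≤ s̄
  1≤s̄ = m<n⇒0<n∸m excess-B

  c̄<n : c̄ < n
  c̄<n = ≤∧≢⇒< (cSearch-≤ B n) λ c̄≡n → ¬Excess-n (bar-diag A) (subst (Excess B) c̄≡n excess-B)

  partialSum-B-c̄ : partialSum B c̄ ≡ c̄ * (c̄ ∸ 1) + s̄
  partialSum-B-c̄ = sym (m+[n∸m]≡n (<⇒≤ excess-B))

  B[_] : ℕ → Mat n
  B[ K ] = bar (peel A K)

  g t : ℕ → ℕ
  g K = partialSum B[ K ] m
  t K = rowSum B[ K ] m

  g-step : ∀ K → g (suc K) ≤ suc (g K)
  g-step K = begin
    partialSum B[ suc K ] m
      ≤⟨ sumTo-mono-≤ m (λ i _ _ → rowSum-step (K % m) (K / m) (bar-peel-step K) i) ⟩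
    sumTo (λ i → rowSum B[ K ] i + δ (suc (K % m)) i) m         ≡⟨ sumTo-+ (rowSum B[ K ]) (δ (suc (K % m))) m ⟩
    g K + sumTo (δ (suc (K % m))) m                            ≤⟨ +-monoʳ-≤ (g K) (sumTo-δ-≤1 (suc (K % m)) m) ⟩
    g K + 1                                                    ≡⟨ +-comm (g K) 1 ⟩
    suc (g K)                                                  ∎
    where open ≤-Reasoning

  t-step : ∀ K → t (suc K) ≤ suc (t K)
  t-step K = ≤-trans (rowSum-step (K % m) (K / m) (bar-peel-step K) m)
                     (≤-trans (+-monoʳ-≤ (t K) (δ-≤1 (suc (K % m)) m)) (≤-reflexive (+-comm (t K) 1)))

  B[0]-rows : ∀ i → rowSum B[ 0 ] i ≡ rowSum B i
  B[0]-rows i = rowSum-cong {M = B[ 0 ]} {M′ = B} i λ x y _ → bar-peel-outside 0 x y λ ()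

  g-0 : g 0 < m * c̄
  g-0 = begin-strict
    g 0                       ≡⟨ sumTo-cong m (λ i _ _ → B[0]-rows i) ⟩
    partialSum B c̄ + v̄        ≡⟨ cong (_+ v̄) partialSum-B-c̄ ⟩
    c̄ * (c̄ ∸ 1) + s̄ + v̄       ≡⟨ +-assoc (c̄ * (c̄ ∸ 1)) s̄ v̄ ⟩
    c̄ * (c̄ ∸ 1) + (s̄ + v̄)     <⟨ +-monoʳ-< (c̄ * (c̄ ∸ 1)) (subst (_< 2 * c̄) (+-comm v̄ s̄) v̄+s̄<2c̄) ⟩
    c̄ * (c̄ ∸ 1) + 2 * c̄       ≡⟨ next-square 1≤c̄ ⟩
    m * c̄                     ∎
    where open ≤-Reasoning

  t-0 : t 0 < w
  t-0 = subst (_< w) (sym (B[0]-rows m)) v̄<w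

  -- the first w columns of row m are all in the front
  t-full : w ≤ t (w * m)
  t-full = ≤-sumTo w n (≤-trans (<⇒≤ w<c̄) (<⇒≤ c̄<n)) filled
    where
    x : Fin n
    x = fromℕ< c̄<n
    filled : ∀ j → 1 ≤ j → j ≤ w → 1 ≤ b2n (ent B[ w * m ] m j)
    filled j 1≤j j≤w with index-toℕ 1≤j (≤-trans j≤w (≤-trans (<⇒≤ w<c̄) (<⇒≤ c̄<n)))
    ... | y , refl = ≤-reflexive (cong b2n (sym (begin
      ent B[ w * m ] m (suc (toℕ y))                   ≡⟨ cong (λ i → ent B[ w * m ] (suc i) (suc (toℕ y))) (toℕ-fromℕ< c̄<n) ⟨
      ent B[ w * m ] (suc (toℕ x)) (suc (toℕ y))       ≡⟨ ent-toℕ B[ w * m ] x y ⟩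
      B[ w * m ] x y                                   ≡⟨ bar-peel-full (subst (_< m) (sym (toℕ-fromℕ< c̄<n)) ≤-refl) j≤w x≢y ⟩
      true                                             ∎)))
      where
      open ≡-Reasoning
      x≢y : x ≢ y
      x≢y x≡y = <⇒≢ (<-trans j≤w w<c̄) (trans (cong toℕ (sym x≡y)) (toℕ-fromℕ< c̄<n))

  Crossed : ℕ → Set
  Crossed K = m * c̄ ≤ g K ⊎ w ≤ t K

  crossing : ∃ λ k → suc k ≤ w * m × ¬ Crossed k × Crossed (suc k)
  crossing = first-crossing (λ k → m * c̄ ≤? g k ⊎-dec w ≤? t k) [ <⇒≱ g-0 , <⇒≱ t-0 ] (inj₂ t-full)

  opaque
    K : ℕ
    K = suc (proj₁ crossing)

    K≤wm : K ≤ w * m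
    K≤wm = proj₁ (proj₂ crossing)

    g-K : g K ≤ m * c̄
    g-K = ≤-trans (g-step (proj₁ crossing)) (≰⇒> λ crossed → proj₁ (proj₂ (proj₂ crossing)) (inj₁ crossed))

    t-K : t K ≤ w
    t-K = ≤-trans (t-step (proj₁ crossing)) (≰⇒> λ crossed → proj₁ (proj₂ (proj₂ crossing)) (inj₂ crossed))

    crossed-K : Crossed K
    crossed-K = proj₂ (proj₂ (proj₂ crossing))

  A₁ : Mat n
  A₁ = peel A K

  ent-A₁ : ∀ i j → i ≤ suc c → ent A₁ i j ≡ ent A i j
  ent-A₁ = ent-rel (λ i _ a b → i ≤ suc c → a ≡ b) (λ _ _ _ → refl) fixed
    where
    fixed : ∀ x y → suc (toℕ x) ≤ suc c → A₁ x y ≡ A x y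
    fixed x y x≤c = peel-fixes {A = A} K≤wm (subst (w ≤_) (sym (opposite-prop x)) (∸-monoʳ-≤ n x≤c)) y

  partialSum-A₁ : ∀ {i} → i ≤ suc c → partialSum A₁ i ≡ partialSum A i
  partialSum-A₁ {i} i≤1+c = sumTo-cong i λ k _ k≤i → sumTo-cong n λ j _ _ → cong b2n (ent-A₁ k j (≤-trans k≤i i≤1+c))

  A₁∈𝒮* : InSStar A₁
  A₁∈𝒮* = peel-InS {A = A} A-noLoops K
        , trans (ent-A₁ 1 2 (s≤s z≤n)) (proj₁ (proj₂ A∈𝒮*))
        , trans (ent-A₁ 2 1 (s≤s 1≤c)) (proj₁ (proj₂ (proj₂ A∈𝒮*)))
        , stays-false (n ∸ 1) n (proj₁ (proj₂ (proj₂ (proj₂ A∈𝒮*))))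
        , stays-false n (n ∸ 1) (proj₁ (proj₂ (proj₂ (proj₂ (proj₂ A∈𝒮*)))))
        , peel-staircase A-staircase K
    where
    stays-false : ∀ i j → ent A i j ≡ false → ent A₁ i j ≡ false
    stays-false i j A-ij = ¬-not λ A₁-ij → contradiction (trans (sym A-ij) (ent-mono (peel-⊆ K) i j A₁-ij)) λ ()

  c₁≡c : cOf A₁ ≡ c
  c₁≡c = cOf-unique A₁ (<⇒≤ c<n) (subst (c * (c ∸ 1) <_) (sym (partialSum-A₁ (n≤1+n c))) (cOf-excess A 1≤c))
           λ i c<i i≤n → cSearch-maximal A n c<i i≤n ∘ λ excess → <-≤-trans excess (partialSum-mono (peel-⊆ K) i)

  v₁≡v : vOf A₁ ≡ vOf A
  v₁≡v = trans (cong (λ c → rowSum A₁ (suc c)) c₁≡c) (sumTo-cong n λ j _ _ → cong b2n (ent-A₁ (suc c) j ≤-refl))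

  s₁≡s : sOf A₁ ≡ sOf A
  s₁≡s = trans (cong (λ c → partialSum A₁ c ∸ c * (c ∸ 1)) c₁≡c) (cong (_∸ c * (c ∸ 1)) (partialSum-A₁ (n≤1+n c)))

  B₁ : Mat n
  B₁ = bar A₁

  B⊆B₁ : B ⊆ B₁
  B⊆B₁ = bar-⊆-bar-peel {A = A} K

  excess-B₁ : Excess B₁ c̄
  excess-B₁ = <-≤-trans excess-B (partialSum-mono B⊆B₁ c̄)

  rowSum-B₁-beyond : ∀ i → m < i → rowSum B₁ i ≤ 2 * c̄
  rowSum-B₁-beyond i m<i = begin
    rowSum B₁ i      ≡⟨ rowSum-cong {M = B₁} {M′ = B} i (λ x y 1+x≡i → bar-peel-outside K x y (beyond 1+x≡i ∘ proj₁)) ⟩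
    rowSum B i       ≤⟨ staircase-rowSum (bar-staircase A-staircase) (s≤s z≤n) (<⇒≤ m<i) ⟩
    v̄ + 1            ≤⟨ +-monoʳ-≤ v̄ 1≤s̄ ⟩
    v̄ + s̄            ≤⟨ <⇒≤ v̄+s̄<2c̄ ⟩
    2 * c̄            ∎
    where
    open ≤-Reasoning
    beyond : ∀ {x : Fin n} → suc (toℕ x) ≡ i → ¬ (toℕ x < m)
    beyond refl x<m = <⇒≱ m<i x<m

  c̄₁≡c̄ : cOf B₁ ≡ c̄
  c̄₁≡c̄ = cOf-unique B₁ (<⇒≤ c̄<n) excess-B₁
           λ i c̄<i _ → ≤⇒≯ (partialSum-≤-beyond B₁ g-K rowSum-B₁-beyond i c̄<i)

  s̄₁ : ℕ
  s̄₁ = partialSum B₁ c̄ ∸ c̄ * (c̄ ∸ 1)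

  v̄₁≡t : vOf B₁ ≡ t K
  v̄₁≡t = cong (λ c → rowSum B₁ (suc c)) c̄₁≡c̄

  s̄₁≡ : sOf B₁ ≡ s̄₁
  s̄₁≡ = cong (λ c → partialSum B₁ c ∸ c * (c ∸ 1)) c̄₁≡c̄

  s̄≤s̄₁ : s̄ ≤ s̄₁
  s̄≤s̄₁ = ∸-monoˡ-≤ (c̄ * (c̄ ∸ 1)) (partialSum-mono B⊆B₁ c̄)

  v̄≤t : v̄ ≤ t K
  v̄≤t = rowSum-mono B⊆B₁ m

  g-K-split : g K ≡ c̄ * (c̄ ∸ 1) + (t K + s̄₁)
  g-K-split = begin
    partialSum B₁ c̄ + t K            ≡⟨ cong (_+ t K) (m+[n∸m]≡n (<⇒≤ excess-B₁)) ⟨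
    c̄ * (c̄ ∸ 1) + s̄₁ + t K          ≡⟨ +-assoc (c̄ * (c̄ ∸ 1)) s̄₁ (t K) ⟩
    c̄ * (c̄ ∸ 1) + (s̄₁ + t K)        ≡⟨ cong (λ a → c̄ * (c̄ ∸ 1) + a) (+-comm s̄₁ (t K)) ⟩
    c̄ * (c̄ ∸ 1) + (t K + s̄₁)        ∎
    where open ≡-Reasoning

  t+s̄₁≤2c̄ : t K + s̄₁ ≤ 2 * c̄
  t+s̄₁≤2c̄ = +-cancelˡ-≤ (c̄ * (c̄ ∸ 1)) (t K + s̄₁) (2 * c̄)
    (subst₂ _≤_ g-K-split (sym (next-square 1≤c̄)) g-K)

  balanced : 2 * c̄ ≤ t K + s̄₁ ⊎ w ≤ t K
  balanced with crossed-K
  ... | inj₁ m*c̄≤g = inj₁ (+-cancelˡ-≤ (c̄ * (c̄ ∸ 1)) (2 * c̄) (t K + s̄₁)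
                            (subst₂ _≤_ (sym (next-square 1≤c̄)) g-K-split m*c̄≤g))
  ... | inj₂ w≤t = inj₂ w≤t

  t≡min : t K ≡ (2 * c̄ ∸ s̄₁) ⊓ w
  t≡min with balanced
  ... | inj₁ 2c̄≤t+s̄₁ = trans t≡2c̄-s̄₁ (sym (m≤n⇒m⊓n≡m (subst (_≤ w) t≡2c̄-s̄₁ t-K)))
    where
    t≡2c̄-s̄₁ : t K ≡ 2 * c̄ ∸ s̄₁
    t≡2c̄-s̄₁ = trans (sym (m+n∸n≡m (t K) s̄₁)) (cong (_∸ s̄₁) (≤-antisym t+s̄₁≤2c̄ 2c̄≤t+s̄₁))
  ... | inj₂ w≤t = trans t≡w (sym (m≥n⇒m⊓n≡n (subst (_≤ 2 * c̄ ∸ s̄₁) t≡w (m+n≤o⇒m≤o∸n (t K) t+s̄₁≤2c̄))))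
    where
    t≡w : t K ≡ w
    t≡w = ≤-antisym t-K w≤t

  v̄+s̄<t+s̄₁ : v̄ + s̄ < t K + s̄₁
  v̄+s̄<t+s̄₁ with balanced
  ... | inj₁ 2c̄≤t+s̄₁ = <-≤-trans v̄+s̄<2c̄ 2c̄≤t+s̄₁
  ... | inj₂ w≤t = +-mono-<-≤ (<-≤-trans v̄<w w≤t) s̄≤s̄₁

  v̄₁≡min : + vOf B₁ ≡ (+ (2 * cOf B₁) ℤ.- + sOf B₁) ℤ.⊓ (+ n ℤ.- + cOf A₁ ℤ.- + 1)
  v̄₁≡min = begin
    + vOf B₁                         ≡⟨ cong +_ (trans v̄₁≡t t≡min) ⟩
    + ((2 * c̄ ∸ s̄₁) ⊓ w)             ≡⟨ ⊓-∸ (≤-trans (m≤n+m s̄₁ (t K)) t+s̄₁≤2c̄) c<n ⟨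
    bound c̄ s̄₁ c                     ≡⟨ cong₂ (λ c̄₁ s̄₁ → bound c̄₁ s̄₁ c) c̄₁≡c̄ s̄₁≡ ⟨
    bound (cOf B₁) (sOf B₁) c        ≡⟨ cong (bound (cOf B₁) (sOf B₁)) c₁≡c ⟨
    bound (cOf B₁) (sOf B₁) (cOf A₁) ∎
    where
    open ≡-Reasoning
    bound : ℕ → ℕ → ℕ → ℤ.ℤ
    bound c̄ s̄ c = (+ (2 * c̄) ℤ.- + s̄) ℤ.⊓ (+ n ℤ.- + c ℤ.- + 1)

  sOf-B≤sOf-B₁ : sOf B ≤ sOf B₁
  sOf-B≤sOf-B₁ = subst (s̄ ≤_) (sym s̄₁≡) s̄≤s̄₁

  φ-A≈φ-A₁ : φ A ≈ᵣ φ A₁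
  φ-A≈φ-A₁ = ≈ᵣ-reflexive (sym φ-A₁)
    where
    φ-A₁ : φ A₁ ≡ φ A
    φ-A₁ = trans (cong (λ c₁ → φ′ c₁ (vOf A₁) (sOf A₁)) c₁≡c) (cong₂ (φ′ c) v₁≡v s₁≡s)

  φ-B<φ-B₁ : φ B <ᵣ φ B₁
  φ-B<φ-B₁ = subst (φ B <ᵣ_) (sym φ-B₁)
    (φ′-strictMono {c̄} {v̄} {s̄} {t K} {s̄₁} 1≤s̄ v̄+s̄<2c̄ t+s̄₁≤2c̄ v̄≤t s̄≤s̄₁ v̄+s̄<t+s̄₁)
    where
    φ-B₁ : φ B₁ ≡ φ′ c̄ (t K) s̄₁
    φ-B₁ = trans (cong (λ c̄₁ → φ′ c̄₁ (vOf B₁) (sOf B₁)) c̄₁≡c̄) (cong₂ (φ′ c̄) v̄₁≡t s̄₁≡)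

open import Data.Integer using (+_; _-_; _⊓_; _<_)
open import Data.Product using (_×_; ∃; _,_)
open import Data.Integer.Properties using (<-≤-trans; i⊓j≤i; i⊓j≤j)
open import Relation.Binary.PropositionalEquality using (_≡_)

lemma3p3 : (n : ℕ) → 3 ≤ n → (A : Mat n) → InSStarSym A →
    n ≤ cOf A + cOf (bar A) →
    (+ vOf (bar A)) < ((+ (2 * cOf (bar A)) - + sOf (bar A)) ⊓ (+ n - + cOf A - + 1)) →
    ∃ λ (A₁ : Mat n) → InSStar A₁ ×
      cOf A₁ ≡ cOf A × vOf A₁ ≡ vOf A × sOf A₁ ≡ sOf A ×
      cOf (bar A₁) ≡ cOf (bar A) ×
      (+ vOf (bar A₁)) ≡ ((+ (2 * cOf (bar A₁)) - + sOf (bar A₁)) ⊓ (+ n - + cOf A₁ - + 1)) ×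
      sOf (bar A) ≤ sOf (bar A₁) ×
      φ A ≈ᵣ φ A₁ ×
      φ (bar A) <ᵣ φ (bar A₁)
lemma3p3 n 3≤n A (A∈𝒮* , _) n≤c+c̄ v̄<min =
  A₁ , A₁∈𝒮* , c₁≡c , v₁≡v , s₁≡s , c̄₁≡c̄ , v̄₁≡min , sOf-B≤sOf-B₁ , φ-A≈φ-A₁ , φ-B<φ-B₁
  where
  open IntegerArithmetic using (+<-∸⇒+<; +<-∸-∸⇒+<)
  open Construction 3≤n A A∈𝒮* n≤c+c̄
    (+<-∸⇒+< (sOf (bar A)) (<-≤-trans v̄<min (i⊓j≤i _ _)))
    (+<-∸-∸⇒+< (<-≤-trans v̄<min (i⊓j≤j _ _)))
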